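{- Fix $n\in\mathbb{N}$, let $e(n)=2^{2^n}$, and let $\mathcal P,\bar{\mathcal P}\subseteq\mathbb{Z}_2[\mathbb{X}]$ be as in the context. Then $$b_{4n}^{e(n)}c_{4n}f_n+c_{4n}s_n\in\langle\mathcal P\rangle\qquad\text{and}\qquad \bar b_{4n}^{e(n)}\bar c_{4n}\bar f_n+\bar c_{4n}\bar s_n\in\langle\bar{\mathcal P}\rangle,$$ where $\langle\cdot\rangle$ denotes the ideal generated in $\mathbb{Z}_2[\mathbb{X}]$.
   Context: $\mathbb{Z}_2$ is the field with two elements. $\mathbb{X}$ is a set of distinct variables containing, for $i\in\{0,\dots,n\}$ and $k\in\{1,2,3,4\}$, the variables $s_i,f_i,q_{ki},c_{ki},b_{ki}$ and their barred counterparts $\bar s_i,\bar f_i,\bar q_{ki},\bar c_{ki},\bar b_{ki}$. Let $\mathcal P=\bigcup_{m=0}^{n}\mathcal P_m$, where $\mathcal P_0=\{b_{i0}^2c_{i0}f_0+c_{i0}s_0 : i\in\{1,2,3,4\}\}$ and, for $1\le m\le n$, $\mathcal P_m$ consists of $q_{1m}c_{1(m-1)}s_{m-1}+s_m$; $q_{2m}c_{2(m-1)}s_{m-1}+q_{1m}b_{1(m-1)}c_{1(m-1)}f_{m-1}$; $q_{3m}c_{3(m-1)}f_{m-1}+q_{2m}c_{2(m-1)}f_{m-1}$; $q_{3m}b_{1(m-1)}c_{3(m-1)}s_{m-1}+q_{2m}b_{4(m-1)}c_{2(m-1)}s_{m-1}$; $q_{4m}b_{4(m-1)}c_{4(m-1)}f_{m-1}+q_{3m}c_{3(m-1)}s_{m-1}$;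 $q_{4m}c_{4(m-1)}s_{m-1}+f_m$; and $q_{2m}b_{3(m-1)}b_{im}c_{im}f_{m-1}+q_{2m}b_{2(m-1)}c_{im}f_{m-1}$ for $i\in\{1,2,3,4\}$. $\bar{\mathcal P}$ is obtained from $\mathcal P$ by replacing every variable $s_i,f_i,q_{ki},c_{ki},b_{ki}$ by $\bar s_i,\bar f_i,\bar q_{ki},\bar c_{ki},\bar b_{ki}$. -}

module Defs where

open import Data.Nat using (ℕ; zero; suc)
open import Data.Fin using (Fin; fromℕ; inject₁) renaming (suc to fsuc)

data Tag : Set where
  plain bar : Tag

data K : Set where
  k1 k2 k3 k4 : K

data Var (n : ℕ) : Set where
  s f     : Tag → Fin (suc n) → Var n
  q c b   : Tag → K → Fin (suc n) → Var n

-- The polynomial ring ℤ₂[V]: the free commutative ring on V with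
-- 1 + 1 = 0, presented as terms modulo the congruence generated by the
-- commutative-ring axioms and characteristic 2.

infixl 6 _+_
infixl 7 _*_
infix 4 _≈_

data Poly (V : Set) : Set where
  var     : V → Poly V
  0# 1#   : Poly V
  _+_ _*_ : Poly V → Poly V → Poly V

data _≈_ {V : Set} : Poly V → Poly V → Set where
  ≈-refl  : ∀ {x} → x ≈ x
  ≈-sym   : ∀ {x y} → x ≈ y → y ≈ x
  ≈-trans : ∀ {x y z} → x ≈ y → y ≈ z → x ≈ z
  +-cong  : ∀ {x y u v} → x ≈ y → u ≈ v → x + u ≈ y + v
  *-cong  : ∀ {x y u v} → x ≈ y → u ≈ v → x * u ≈ y * v
  +-assoc : ∀ x y z → (x + y) + z ≈ x + (y + z)
  +-comm  : ∀ x y → x + y ≈ y + x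
  +-idˡ   : ∀ x → 0# + x ≈ x
  *-assoc : ∀ x y z → (x * y) * z ≈ x * (y * z)
  *-comm  : ∀ x y → x * y ≈ y * x
  *-idˡ   : ∀ x → 1# * x ≈ x
  *-zeroˡ : ∀ x → 0# * x ≈ 0#
  distribʳ : ∀ x y z → (y + z) * x ≈ y * x + z * x
  char2   : ∀ x → x + x ≈ 0#

infixr 8 _^_
_^_ : {V : Set} → Poly V → ℕ → Poly V
p ^ zero  = 1#
p ^ suc k = p * (p ^ k)

data _∈⟨_⟩ {V : Set} : Poly V → (Poly V → Set) → Set₁ where
  gen  : ∀ {G g} → G g → g ∈⟨ G ⟩
  zer  : ∀ {G} → 0# ∈⟨ G ⟩
  add  : ∀ {G p p'} → p ∈⟨ G ⟩ → p' ∈⟨ G ⟩ → (p + p') ∈⟨ G ⟩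
  mul  : ∀ {G p} (a : Poly V) → p ∈⟨ G ⟩ → (a * p) ∈⟨ G ⟩
  resp : ∀ {G p p'} → p ≈ p' → p ∈⟨ G ⟩ → p' ∈⟨ G ⟩

module _ {n : ℕ} (t : Tag) where
  S F : Fin (suc n) → Poly (Var n)
  S i = var (s t i)
  F i = var (f t i)
  Q C B : K → Fin (suc n) → Poly (Var n)
  Q k i = var (q t k i)
  C k i = var (c t k i)
  B k i = var (b t k i)

-- Gen t n p  :  p ∈ 𝒫 (t = plain) resp. p ∈ 𝒫̄ (t = bar).
-- Index m ∈ {1..n} is represented by m : Fin n, with
--   "m"   = fsuc m     : Fin (suc n)
--   "m-1" = inject₁ m  : Fin (suc n)
data Gen (t : Tag) (n : ℕ) : Poly (Var n) → Set where
  p0 : ∀ i → Gen t n (B t i Fin.zero ^ 2 * C t i Fin.zero * F t Fin.zero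
                      + C t i Fin.zero * S t Fin.zero)
  pm1 : ∀ (m : Fin n) → Gen t n
    (Q t k1 (fsuc m) * C t k1 (inject₁ m) * S t (inject₁ m) + S t (fsuc m))
  pm2 : ∀ (m : Fin n) → Gen t n
    (Q t k2 (fsuc m) * C t k2 (inject₁ m) * S t (inject₁ m)
     + Q t k1 (fsuc m) * B t k1 (inject₁ m) * C t k1 (inject₁ m) * F t (inject₁ m))
  pm3 : ∀ (m : Fin n) → Gen t n
    (Q t k3 (fsuc m) * C t k3 (inject₁ m) * F t (inject₁ m)
     + Q t k2 (fsuc m) * C t k2 (inject₁ m) * F t (inject₁ m))
  pm4 : ∀ (m : Fin n) → Gen t n
    (Q t k3 (fsuc m) * B t k1 (inject₁ m) * C t k3 (inject₁ m) * S t (inject₁ m)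
     + Q t k2 (fsuc m) * B t k4 (inject₁ m) * C t k2 (inject₁ m) * S t (inject₁ m))
  pm5 : ∀ (m : Fin n) → Gen t n
    (Q t k4 (fsuc m) * B t k4 (inject₁ m) * C t k4 (inject₁ m) * F t (inject₁ m)
     + Q t k3 (fsuc m) * C t k3 (inject₁ m) * S t (inject₁ m))
  pm6 : ∀ (m : Fin n) → Gen t n
    (Q t k4 (fsuc m) * C t k4 (inject₁ m) * S t (inject₁ m) + F t (fsuc m))
  pm7 : ∀ (m : Fin n) (i : K) → Gen t n
    (Q t k2 (fsuc m) * B t k3 (inject₁ m) * B t i (fsuc m) * C t i (fsuc m) * F t (inject₁ m)
     + Q t k2 (fsuc m) * B t k2 (inject₁ m) * C t i (fsuc m) * F t (inject₁ m))

e : ℕ → ℕ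
e n = 2 Data.Nat.^ (2 Data.Nat.^ n)

target : Tag → (n : ℕ) → Poly (Var n)
target t n = B t k4 (fromℕ n) ^ e n * C t k4 (fromℕ n) * F t (fromℕ n)
           + C t k4 (fromℕ n) * S t (fromℕ n)

{-# OPTIONS --safe #-}
module Submission where

open import Defs
open import Data.Nat using (ℕ)
open import Data.Product using (_×_)
open import Data.Nat using (zero; suc; NonZero)
open import Data.Product using (_,_)
import Data.Nat as ℕ
import Data.Nat.Properties as ℕₚ
open import Data.Fin using (Fin; fromℕ; inject₁; toℕ) renaming (suc to fsuc)
open import Data.Fin.Induction using (<-weakInduction)
open import Data.Fin.Properties using (toℕ-inject₁; toℕ-fromℕ)
open import Relation.Binary.PropositionalEquality as ≡ using (_≡_)
open import Algebra.Bundles using (CommutativeMonoid)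
import Algebra.Properties.CommutativeMonoid.Mult as Mult
import Algebra.Properties.CommutativeSemigroup as CommutativeSemigroupProperties
import Algebra.Solver.CommutativeMonoid as CommutativeMonoidSolver
import Relation.Binary.Reasoning.Setoid as SetoidReasoning

-- Work modulo ⟨𝒫⟩ and show by induction on the level m that
-- b_{km}^{e(m)} c_{km} f_m ≡ c_{km} s_m for all k.  Suppose this holds at level
-- m − 1 with exponent E, and write b_k, c_k, s, f for the variables of level
-- m − 1 and q_k for those of level m.  The generators of 𝒫_m turn both sides
-- at level m into multiples of the single monomial Z = b₃^E c₂ q₂ c_{im} f:
--   c_{im} s_m ≡ b₁^{E−1} b_{im}^E Z   and   c_{im} f_m ≡ b₄^{E−1} Z,
-- and on multiples of Z the factor b₁ may be traded for b₄ b_{im}^E.  Hence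
--   b_{im}^{E²} c_{im} f_m ≡ b_{im}^E (b₄ b_{im}^E)^{E−1} Z ≡ b_{im}^E b₁^{E−1} Z ≡ c_{im} s_m,
-- and E² is the next exponent because e(m) = e(m − 1)².

module _ {c ℓ} (M : CommutativeMonoid c ℓ) where
  open CommutativeMonoid M renaming (_≈_ to _≈ᴹ_)
  open Mult M using () renaming (_×_ to _×ᴹ_)
  open CommutativeSemigroupProperties commutativeSemigroup using (x∙yz≈y∙xz)
  open SetoidReasoning setoid

  ×ᴹ-agree-on : ∀ {x y z} → x ∙ z ≈ᴹ y ∙ z → ∀ k → k ×ᴹ x ∙ z ≈ᴹ k ×ᴹ y ∙ z
  ×ᴹ-agree-on _ zero = refl
  ×ᴹ-agree-on {x} {y} {z} xz≈yz (suc k) = begin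
    x ∙ k ×ᴹ x ∙ z    ≈⟨ assoc x (k ×ᴹ x) z ⟩
    x ∙ (k ×ᴹ x ∙ z)  ≈⟨ ∙-congˡ (×ᴹ-agree-on xz≈yz k) ⟩
    x ∙ (k ×ᴹ y ∙ z)  ≈⟨ x∙yz≈y∙xz x (k ×ᴹ y) z ⟩
    k ×ᴹ y ∙ (x ∙ z)  ≈⟨ ∙-congˡ xz≈yz ⟩
    k ×ᴹ y ∙ (y ∙ z)  ≈⟨ x∙yz≈y∙xz (k ×ᴹ y) y z ⟩
    y ∙ (k ×ᴹ y ∙ z)  ≈⟨ assoc y (k ×ᴹ y) z ⟨
    y ∙ k ×ᴹ y ∙ z    ∎

*-distribˡ-+ : ∀ {V : Set} (a x y : Poly V) → a * (x + y) ≈ a * x + a * y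
*-distribˡ-+ a x y =
  ≈-trans (*-comm a (x + y)) (≈-trans (distribʳ a x y) (+-cong (*-comm x a) (*-comm y a)))

module Quotient {V : Set} (G : Poly V → Set) where

  -- Congruence modulo ⟨ G ⟩: in characteristic 2 the difference x − y is x + y.
  infix 4 _∼_
  _∼_ : Poly V → Poly V → Set₁
  x ∼ y = (x + y) ∈⟨ G ⟩

  ≈⇒∼ : ∀ {x y} → x ≈ y → x ∼ y
  ≈⇒∼ {x} {y} x≈y = resp (≈-sym (≈-trans (+-cong x≈y ≈-refl) (char2 y))) zer

  ∼-sym : ∀ {x y} → x ∼ y → y ∼ x
  ∼-sym {x} {y} = resp (+-comm x y)

  ∼-trans : ∀ {x y z} → x ∼ y → y ∼ z → x ∼ z
  ∼-trans {x} {y} {z} x∼y y∼z = resp cancel-y (add x∼y y∼z)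
    where
    cancel-y : (x + y) + (y + z) ≈ x + z
    cancel-y = ≈-trans (+-assoc x y (y + z)) (+-cong ≈-refl
      (≈-trans (≈-sym (+-assoc y y z)) (≈-trans (+-cong (char2 y) ≈-refl) (+-idˡ z))))

  *-congˡ-∼ : ∀ a {x y} → x ∼ y → a * x ∼ a * y
  *-congˡ-∼ a {x} {y} x∼y = resp (*-distribˡ-+ a x y) (mul a x∼y)

  *-cong-∼ : ∀ {x y u v} → x ∼ y → u ∼ v → x * u ∼ y * v
  *-cong-∼ {x} {y} {u} x∼y u∼v =
    ∼-trans (resp (+-cong (*-comm u x) (*-comm u y)) (*-congˡ-∼ u x∼y)) (*-congˡ-∼ y u∼v)

  *-commutativeMonoid : CommutativeMonoid _ _
  *-commutativeMonoid = record
    { Carrier = Poly V ; _≈_ = _∼_ ; _∙_ = _*_ ; ε = 1#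
    ; isCommutativeMonoid = record
      { isMonoid = record
        { isSemigroup = record
          { isMagma = record
            { isEquivalence = record { refl = ≈⇒∼ ≈-refl ; sym = ∼-sym ; trans = ∼-trans }
            ; ∙-cong = *-cong-∼ }
          ; assoc = λ x y z → ≈⇒∼ (*-assoc x y z) }
        ; identity = (λ x → ≈⇒∼ (*-idˡ x)) , (λ x → ≈⇒∼ (≈-trans (*-comm x 1#) (*-idˡ x))) }
      ; comm = λ x y → ≈⇒∼ (*-comm x y) } }

  open Mult *-commutativeMonoid using (×-distrib-+; ×-assocˡ) renaming (_×_ to _×ᴹ_)
  open SetoidReasoning (CommutativeMonoid.setoid *-commutativeMonoid)

  ^≡×ᴹ : ∀ x k → x ^ k ≡ k ×ᴹ x
  ^≡×ᴹ x zero    = ≡.refl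
  ^≡×ᴹ x (suc k) = ≡.cong (x *_) (^≡×ᴹ x k)

  ^-agree-on : ∀ {x y z} → x * z ∼ y * z → ∀ k → x ^ k * z ∼ y ^ k * z
  ^-agree-on {x} {y} xz∼yz k rewrite ^≡×ᴹ x k | ^≡×ᴹ y k =
    ×ᴹ-agree-on *-commutativeMonoid xz∼yz k

  ^-distrib-* : ∀ x y k → (x * y) ^ k ∼ x ^ k * y ^ k
  ^-distrib-* x y k rewrite ^≡×ᴹ (x * y) k | ^≡×ᴹ x k | ^≡×ᴹ y k = ×-distrib-+ x y k

  ^-*-assoc : ∀ x m k → (x ^ m) ^ k ∼ x ^ (k ℕ.* m)
  ^-*-assoc x m k = begin
    (x ^ m) ^ k      ≡⟨ ^≡×ᴹ (x ^ m) k ⟩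
    k ×ᴹ x ^ m       ≡⟨ ≡.cong (k ×ᴹ_) (^≡×ᴹ x m) ⟩
    k ×ᴹ m ×ᴹ x      ≈⟨ ×-assocˡ x k m ⟩
    (k ℕ.* m) ×ᴹ x   ≡⟨ ^≡×ᴹ x (k ℕ.* m) ⟨
    x ^ (k ℕ.* m)    ∎

e-suc : ∀ k → e (suc k) ≡ e k ℕ.* e k
e-suc k = ≡.trans (≡.cong (λ m → 2 ℕ.^ (2 ℕ.^ k ℕ.+ m)) (ℕₚ.+-identityʳ (2 ℕ.^ k)))
                  (ℕₚ.^-distribˡ-+-* 2 (2 ℕ.^ k) (2 ℕ.^ k))

module Levels (t : Tag) (n : ℕ) where
  open Quotient (Gen t n)
  open CommutativeMonoid *-commutativeMonoid using (setoid; refl; assoc; ∙-congˡ; ∙-congʳ)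
  open SetoidReasoning setoid
  open CommutativeMonoidSolver *-commutativeMonoid using (Expr; solve; _⊜_; _⊕_)

  -- Left-nested like _*_, so that solver terms evaluate to the very Poly terms of the chains.
  infixl 7 _·_
  _·_ : ∀ {k} → Expr k → Expr k → Expr k
  _·_ = _⊕_

  𝒫₀-holds : Fin (suc n) → ℕ → Set₁
  𝒫₀-holds ℓ E = ∀ k → B t k ℓ ^ E * C t k ℓ * F t ℓ ∼ C t k ℓ * S t ℓ

  module Step (j : Fin n) (E′ : ℕ) (ih : 𝒫₀-holds (inject₁ j) (suc E′)) (i : K) where
    E : ℕ
    E = suc E′

    q₁ q₂ q₃ q₄ bᵢ cᵢ sₘ fₘ b₁ b₂ b₃ b₄ c₁ c₂ c₃ c₄ sₚ fₚ W Z : Poly (Var n)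
    q₁ = Q t k1 (fsuc j)
    q₂ = Q t k2 (fsuc j)
    q₃ = Q t k3 (fsuc j)
    q₄ = Q t k4 (fsuc j)
    bᵢ = B t i (fsuc j)
    cᵢ = C t i (fsuc j)
    sₘ = S t (fsuc j)
    fₘ = F t (fsuc j)
    b₁ = B t k1 (inject₁ j)
    b₂ = B t k2 (inject₁ j)
    b₃ = B t k3 (inject₁ j)
    b₄ = B t k4 (inject₁ j)
    c₁ = C t k1 (inject₁ j)
    c₂ = C t k2 (inject₁ j)
    c₃ = C t k3 (inject₁ j)
    c₄ = C t k4 (inject₁ j)
    sₚ = S t (inject₁ j)
    fₚ = F t (inject₁ j)
    W = q₂ * cᵢ * fₚ
    Z = b₃ ^ E * (c₂ * W)

    b₂W∼b₃bᵢW : b₂ * W ∼ b₃ * bᵢ * W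
    b₂W∼b₃bᵢW = begin
      b₂ * W
        ≈⟨ solve 4 (λ q₂ b₂ cᵢ fₚ → b₂ · (q₂ · cᵢ · fₚ) ⊜ q₂ · b₂ · cᵢ · fₚ) refl q₂ b₂ cᵢ fₚ ⟩
      q₂ * b₂ * cᵢ * fₚ
        ≈⟨ gen (pm7 j i) ⟨
      q₂ * b₃ * bᵢ * cᵢ * fₚ
        ≈⟨ solve 5 (λ q₂ b₃ bᵢ cᵢ fₚ → q₂ · b₃ · bᵢ · cᵢ · fₚ ⊜ b₃ · bᵢ · (q₂ · cᵢ · fₚ))
                   refl q₂ b₃ bᵢ cᵢ fₚ ⟩
      b₃ * bᵢ * W ∎

    b₂ᴱW∼b₃ᴱbᵢᴱW : b₂ ^ E * W ∼ b₃ ^ E * bᵢ ^ E * W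
    b₂ᴱW∼b₃ᴱbᵢᴱW = begin
      b₂ ^ E * W
        ≈⟨ ^-agree-on b₂W∼b₃bᵢW E ⟩
      (b₃ * bᵢ) ^ E * W
        ≈⟨ ∙-congʳ (^-distrib-* b₃ bᵢ E) ⟩
      b₃ ^ E * bᵢ ^ E * W ∎

    cᵢsₘ∼b₁ᴱ′bᵢᴱZ : cᵢ * sₘ ∼ b₁ ^ E′ * bᵢ ^ E * Z
    cᵢsₘ∼b₁ᴱ′bᵢᴱZ = begin
      cᵢ * sₘ
        ≈⟨ ∙-congˡ (gen (pm1 j)) ⟨
      cᵢ * (q₁ * c₁ * sₚ)
        ≈⟨ solve 4 (λ cᵢ q₁ c₁ sₚ → cᵢ · (q₁ · c₁ · sₚ) ⊜ cᵢ · q₁ · (c₁ · sₚ)) refl cᵢ q₁ c₁ sₚ ⟩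
      cᵢ * q₁ * (c₁ * sₚ)
        ≈⟨ ∙-congˡ (ih k1) ⟨
      cᵢ * q₁ * (b₁ ^ E * c₁ * fₚ)
        ≈⟨ solve 6 (λ cᵢ q₁ b₁ b₁ᴱ′ c₁ fₚ → cᵢ · q₁ · (b₁ · b₁ᴱ′ · c₁ · fₚ) ⊜ cᵢ · b₁ᴱ′ · (q₁ · b₁ · c₁ · fₚ))
                   refl cᵢ q₁ b₁ (b₁ ^ E′) c₁ fₚ ⟩
      cᵢ * b₁ ^ E′ * (q₁ * b₁ * c₁ * fₚ)
        ≈⟨ ∙-congˡ (gen (pm2 j)) ⟨
      cᵢ * b₁ ^ E′ * (q₂ * c₂ * sₚ)
        ≈⟨ solve 5 (λ cᵢ b₁ᴱ′ q₂ c₂ sₚ → cᵢ · b₁ᴱ′ · (q₂ · c₂ · sₚ) ⊜ cᵢ · b₁ᴱ′ · q₂ · (c₂ · sₚ))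
                   refl cᵢ (b₁ ^ E′) q₂ c₂ sₚ ⟩
      cᵢ * b₁ ^ E′ * q₂ * (c₂ * sₚ)
        ≈⟨ ∙-congˡ (ih k2) ⟨
      cᵢ * b₁ ^ E′ * q₂ * (b₂ ^ E * c₂ * fₚ)
        ≈⟨ solve 6 (λ cᵢ b₁ᴱ′ q₂ b₂ᴱ c₂ fₚ → cᵢ · b₁ᴱ′ · q₂ · (b₂ᴱ · c₂ · fₚ) ⊜ b₁ᴱ′ · c₂ · (b₂ᴱ · (q₂ · cᵢ · fₚ)))
                   refl cᵢ (b₁ ^ E′) q₂ (b₂ ^ E) c₂ fₚ ⟩
      b₁ ^ E′ * c₂ * (b₂ ^ E * W)
        ≈⟨ ∙-congˡ b₂ᴱW∼b₃ᴱbᵢᴱW ⟩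
      b₁ ^ E′ * c₂ * (b₃ ^ E * bᵢ ^ E * W)
        ≈⟨ solve 5 (λ b₁ᴱ′ c₂ b₃ᴱ bᵢᴱ W → b₁ᴱ′ · c₂ · (b₃ᴱ · bᵢᴱ · W) ⊜ b₁ᴱ′ · bᵢᴱ · (b₃ᴱ · (c₂ · W)))
                   refl (b₁ ^ E′) c₂ (b₃ ^ E) (bᵢ ^ E) W ⟩
      b₁ ^ E′ * bᵢ ^ E * Z ∎

    cᵢfₘ∼b₄ᴱ′Z : cᵢ * fₘ ∼ b₄ ^ E′ * Z
    cᵢfₘ∼b₄ᴱ′Z = begin
      cᵢ * fₘ
        ≈⟨ ∙-congˡ (gen (pm6 j)) ⟨
      cᵢ * (q₄ * c₄ * sₚ)
        ≈⟨ solve 4 (λ cᵢ q₄ c₄ sₚ → cᵢ · (q₄ · c₄ · sₚ) ⊜ cᵢ · q₄ · (c₄ · sₚ)) refl cᵢ q₄ c₄ sₚ ⟩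
      cᵢ * q₄ * (c₄ * sₚ)
        ≈⟨ ∙-congˡ (ih k4) ⟨
      cᵢ * q₄ * (b₄ ^ E * c₄ * fₚ)
        ≈⟨ solve 6 (λ cᵢ q₄ b₄ b₄ᴱ′ c₄ fₚ → cᵢ · q₄ · (b₄ · b₄ᴱ′ · c₄ · fₚ) ⊜ cᵢ · b₄ᴱ′ · (q₄ · b₄ · c₄ · fₚ))
                   refl cᵢ q₄ b₄ (b₄ ^ E′) c₄ fₚ ⟩
      cᵢ * b₄ ^ E′ * (q₄ * b₄ * c₄ * fₚ)
        ≈⟨ ∙-congˡ (gen (pm5 j)) ⟩
      cᵢ * b₄ ^ E′ * (q₃ * c₃ * sₚ)
        ≈⟨ solve 5 (λ cᵢ b₄ᴱ′ q₃ c₃ sₚ → cᵢ · b₄ᴱ′ · (q₃ · c₃ · sₚ) ⊜ cᵢ · b₄ᴱ′ · q₃ · (c₃ · sₚ))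
                   refl cᵢ (b₄ ^ E′) q₃ c₃ sₚ ⟩
      cᵢ * b₄ ^ E′ * q₃ * (c₃ * sₚ)
        ≈⟨ ∙-congˡ (ih k3) ⟨
      cᵢ * b₄ ^ E′ * q₃ * (b₃ ^ E * c₃ * fₚ)
        ≈⟨ solve 6 (λ cᵢ b₄ᴱ′ q₃ b₃ᴱ c₃ fₚ → cᵢ · b₄ᴱ′ · q₃ · (b₃ᴱ · c₃ · fₚ) ⊜ cᵢ · b₄ᴱ′ · b₃ᴱ · (q₃ · c₃ · fₚ))
                   refl cᵢ (b₄ ^ E′) q₃ (b₃ ^ E) c₃ fₚ ⟩
      cᵢ * b₄ ^ E′ * b₃ ^ E * (q₃ * c₃ * fₚ)
        ≈⟨ ∙-congˡ (gen (pm3 j)) ⟩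
      cᵢ * b₄ ^ E′ * b₃ ^ E * (q₂ * c₂ * fₚ)
        ≈⟨ solve 6 (λ cᵢ b₄ᴱ′ b₃ᴱ q₂ c₂ fₚ → cᵢ · b₄ᴱ′ · b₃ᴱ · (q₂ · c₂ · fₚ) ⊜ b₄ᴱ′ · (b₃ᴱ · (c₂ · (q₂ · cᵢ · fₚ))))
                   refl cᵢ (b₄ ^ E′) (b₃ ^ E) q₂ c₂ fₚ ⟩
      b₄ ^ E′ * Z ∎

    b₁Z∼b₄bᵢᴱZ : b₁ * Z ∼ b₄ * bᵢ ^ E * Z
    b₁Z∼b₄bᵢᴱZ = begin
      b₁ * Z
        ≈⟨ solve 6 (λ b₁ b₃ᴱ c₂ q₂ cᵢ fₚ → b₁ · (b₃ᴱ · (c₂ · (q₂ · cᵢ · fₚ))) ⊜ b₁ · b₃ᴱ · cᵢ · (q₂ · c₂ · fₚ))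
                   refl b₁ (b₃ ^ E) c₂ q₂ cᵢ fₚ ⟩
      b₁ * b₃ ^ E * cᵢ * (q₂ * c₂ * fₚ)
        ≈⟨ ∙-congˡ (gen (pm3 j)) ⟨
      b₁ * b₃ ^ E * cᵢ * (q₃ * c₃ * fₚ)
        ≈⟨ solve 6 (λ b₁ b₃ᴱ cᵢ q₃ c₃ fₚ → b₁ · b₃ᴱ · cᵢ · (q₃ · c₃ · fₚ) ⊜ b₁ · cᵢ · q₃ · (b₃ᴱ · c₃ · fₚ))
                   refl b₁ (b₃ ^ E) cᵢ q₃ c₃ fₚ ⟩
      b₁ * cᵢ * q₃ * (b₃ ^ E * c₃ * fₚ)
        ≈⟨ ∙-congˡ (ih k3) ⟩
      b₁ * cᵢ * q₃ * (c₃ * sₚ)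
        ≈⟨ solve 5 (λ b₁ cᵢ q₃ c₃ sₚ → b₁ · cᵢ · q₃ · (c₃ · sₚ) ⊜ cᵢ · (q₃ · b₁ · c₃ · sₚ))
                   refl b₁ cᵢ q₃ c₃ sₚ ⟩
      cᵢ * (q₃ * b₁ * c₃ * sₚ)
        ≈⟨ ∙-congˡ (gen (pm4 j)) ⟩
      cᵢ * (q₂ * b₄ * c₂ * sₚ)
        ≈⟨ solve 5 (λ cᵢ q₂ b₄ c₂ sₚ → cᵢ · (q₂ · b₄ · c₂ · sₚ) ⊜ cᵢ · q₂ · b₄ · (c₂ · sₚ))
                   refl cᵢ q₂ b₄ c₂ sₚ ⟩
      cᵢ * q₂ * b₄ * (c₂ * sₚ)
        ≈⟨ ∙-congˡ (ih k2) ⟨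
      cᵢ * q₂ * b₄ * (b₂ ^ E * c₂ * fₚ)
        ≈⟨ solve 6 (λ cᵢ q₂ b₄ b₂ᴱ c₂ fₚ → cᵢ · q₂ · b₄ · (b₂ᴱ · c₂ · fₚ) ⊜ b₄ · c₂ · (b₂ᴱ · (q₂ · cᵢ · fₚ)))
                   refl cᵢ q₂ b₄ (b₂ ^ E) c₂ fₚ ⟩
      b₄ * c₂ * (b₂ ^ E * W)
        ≈⟨ ∙-congˡ b₂ᴱW∼b₃ᴱbᵢᴱW ⟩
      b₄ * c₂ * (b₃ ^ E * bᵢ ^ E * W)
        ≈⟨ solve 5 (λ b₄ c₂ b₃ᴱ bᵢᴱ W → b₄ · c₂ · (b₃ᴱ · bᵢᴱ · W) ⊜ b₄ · bᵢᴱ · (b₃ᴱ · (c₂ · W)))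
                   refl b₄ c₂ (b₃ ^ E) (bᵢ ^ E) W ⟩
      b₄ * bᵢ ^ E * Z ∎

    bᵢᴱᴱcᵢfₘ∼cᵢsₘ : bᵢ ^ (E ℕ.* E) * cᵢ * fₘ ∼ cᵢ * sₘ
    bᵢᴱᴱcᵢfₘ∼cᵢsₘ = begin
      bᵢ ^ (E ℕ.* E) * cᵢ * fₘ
        ≈⟨ ∙-congʳ (∙-congʳ (^-*-assoc bᵢ E E)) ⟨
      (bᵢ ^ E) ^ E * cᵢ * fₘ
        ≈⟨ assoc ((bᵢ ^ E) ^ E) cᵢ fₘ ⟩
      (bᵢ ^ E) ^ E * (cᵢ * fₘ)
        ≈⟨ ∙-congˡ cᵢfₘ∼b₄ᴱ′Z ⟩
      (bᵢ ^ E) ^ E * (b₄ ^ E′ * Z)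
        ≈⟨ solve 4 (λ bᵢᴱ bᵢᴱᴱ′ b₄ᴱ′ Z → bᵢᴱ · bᵢᴱᴱ′ · (b₄ᴱ′ · Z) ⊜ bᵢᴱ · (b₄ᴱ′ · bᵢᴱᴱ′ · Z))
                   refl (bᵢ ^ E) ((bᵢ ^ E) ^ E′) (b₄ ^ E′) Z ⟩
      bᵢ ^ E * (b₄ ^ E′ * (bᵢ ^ E) ^ E′ * Z)
        ≈⟨ ∙-congˡ (∙-congʳ (^-distrib-* b₄ (bᵢ ^ E) E′)) ⟨
      bᵢ ^ E * ((b₄ * bᵢ ^ E) ^ E′ * Z)
        ≈⟨ ∙-congˡ (^-agree-on b₁Z∼b₄bᵢᴱZ E′) ⟨
      bᵢ ^ E * (b₁ ^ E′ * Z)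
        ≈⟨ solve 3 (λ bᵢᴱ b₁ᴱ′ Z → bᵢᴱ · (b₁ᴱ′ · Z) ⊜ b₁ᴱ′ · bᵢᴱ · Z) refl (bᵢ ^ E) (b₁ ^ E′) Z ⟩
      b₁ ^ E′ * bᵢ ^ E * Z
        ≈⟨ cᵢsₘ∼b₁ᴱ′bᵢᴱZ ⟨
      cᵢ * sₘ ∎

  𝒫₀-holds-step : ∀ j E .{{_ : NonZero E}} → 𝒫₀-holds (inject₁ j) E → 𝒫₀-holds (fsuc j) (E ℕ.* E)
  𝒫₀-holds-step j (suc E′) ih i = Step.bᵢᴱᴱcᵢfₘ∼cᵢsₘ j E′ ih i

  𝒫₀-holds-everywhere : ∀ ℓ → 𝒫₀-holds ℓ (e (toℕ ℓ))
  𝒫₀-holds-everywhere = <-weakInduction (λ ℓ → 𝒫₀-holds ℓ (e (toℕ ℓ))) (λ k → gen (p0 k)) step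
    where
    step : ∀ j → 𝒫₀-holds (inject₁ j) (e (toℕ (inject₁ j))) → 𝒫₀-holds (fsuc j) (e (suc (toℕ j)))
    step j ih rewrite toℕ-inject₁ j | e-suc (toℕ j) =
      𝒫₀-holds-step j (e (toℕ j)) {{ℕₚ.m^n≢0 2 (2 ℕ.^ toℕ j)}} ih

  target∈⟨Gen⟩ : target t n ∈⟨ Gen t n ⟩
  target∈⟨Gen⟩ = ≡.subst (λ k → 𝒫₀-holds (fromℕ n) (e k)) (toℕ-fromℕ n) (𝒫₀-holds-everywhere (fromℕ n)) k4

proposition4p2 : (n : ℕ) → (target plain n ∈⟨ Gen plain n ⟩) × (target bar n ∈⟨ Gen bar n ⟩)
proposition4p2 n = Levels.target∈⟨Gen⟩ plain n , Levels.target∈⟨Gen⟩ bar n
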